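{- For integers $n\ge0$, $m\ge0$, let $B^{Q}(n,m)$ be the number of vertically constrained $S_{DW}$ paths from $(0,0)$ to $(n,m)$ all of whose vertices have $y\ge0$ (first step arbitrary). Then $B^{Q}(0,m)=1$ if $m\in\{0,1\}$ and $0$ otherwise; for $n>0$, $$B^{Q}(n,0)=B^{Q}(n-1,2)+B^{Q}(n-1,1)+B^{Q}(n-1,0),$$ $$B^{Q}(n,1)=B^{Q}(n-1,3)+B^{Q}(n-1,2)+2B^{Q}(n-1,1)+B^{Q}(n-1,0),$$ and for $n>0$, $m>1$, $$B^{Q}(n,m)=B^{Q}(n-1,m+2)+B^{Q}(n-1,m+1)+2B^{Q}(n-1,m)+B^{Q}(n-1,m-1)+B^{Q}(n-1,m-2).$$
   Context: A lattice path is a finite sequence of steps (vectors in $\mathbb{Z}^2$) starting at $(0,0)$; its vertices are the partial sums, and it terminates at the last vertex (the empty path terminates at $(0,0)$). Let $S_D=\{(1,1),(1,-1)\}$ and $S_{DW}=S_D\cup\{(0,1),(0,-1)\}$; $(0,\pm1)$ are vertical steps. A vertically constrained $S_{DW}$ path is a lattice path with steps in $S_{DW}$ in which no two consecutive steps are both vertical. -}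

module Defs where

open import Data.Nat using (ℕ; zero; suc)
open import Data.Integer using (ℤ; +_; -[1+_]; _+_; _≤_)
open import Data.Product using (Σ; _×_; _,_; proj₂)
open import Data.List using (List; []; _∷_)
open import Data.List.Relation.Unary.All using (All)
open import Data.Fin using (Fin)
open import Function.Bundles using (_↔_)
open import Relation.Binary.PropositionalEquality using (_≡_)

data Step : Set where
  up down north south : Step

vecOf : Step → ℤ × ℤ
vecOf up    = (+ 1 , + 1)
vecOf down  = (+ 1 , -[1+ 0 ])
vecOf north = (+ 0 , + 1)
vecOf south = (+ 0 , -[1+ 0 ])

addV : ℤ × ℤ → ℤ × ℤ → ℤ × ℤ
addV (a , b) (c , d) = (a + c , b + d)

verticesFrom : ℤ × ℤ → List Step → List (ℤ × ℤ)
verticesFrom v []       = v ∷ []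
verticesFrom v (s ∷ ss) = v ∷ verticesFrom (addV v (vecOf s)) ss

vertices : List Step → List (ℤ × ℤ)
vertices = verticesFrom (+ 0 , + 0)

endFrom : ℤ × ℤ → List Step → ℤ × ℤ
endFrom v []       = v
endFrom v (s ∷ ss) = endFrom (addV v (vecOf s)) ss

endpoint : List Step → ℤ × ℤ
endpoint = endFrom (+ 0 , + 0)

data Vertical : Step → Set where
  north-v : Vertical north
  south-v : Vertical south

data Diagonal : Step → Set where
  up-d   : Diagonal up
  down-d : Diagonal down

-- no two consecutive steps are both vertical
data VertConstrained : List Step → Set where
  vc-nil  : VertConstrained []
  vc-one  : ∀ s → VertConstrained (s ∷ [])
  vc-diag₁ : ∀ {s t ss} → Diagonal s → VertConstrained (t ∷ ss) → VertConstrained (s ∷ t ∷ ss)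
  vc-diag₂ : ∀ {s t ss} → Vertical s → Diagonal t → VertConstrained (t ∷ ss) → VertConstrained (s ∷ t ∷ ss)

QPath : ℕ → ℕ → Set
QPath n m = Σ (List Step) λ p →
  VertConstrained p × All (λ v → + 0 ≤ proj₂ v) (vertices p) × endpoint p ≡ (+ n , + m)

Counts : (ℕ → ℕ → ℕ) → Set
Counts B = ∀ n m → Fin (B n m) ↔ QPath n m

-- A path ending in column n + 1 ends with a diagonal step followed by at most one vertical
-- step, since two vertical steps are never adjacent. Removing this final block, one of six,
-- leaves a counted path ending in column n; conversely a block can be appended to such a
-- path exactly when its vertices stay above the axis. Sorting the six blocks by the height
-- at which they start gives the recurrence; ↗↓ and ↘↑ both start at height m, whence the
-- coefficient 2. Column 0 admits no diagonal step, leaving only the empty path and the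
-- single step north.
module Submission where

open import Axiom.UniquenessOfIdentityProofs using (module Decidable⇒UIP)
open import Data.Empty using (⊥; ⊥-elim)
open import Data.Fin as Fin using (Fin)
open import Data.Fin.Permutation using (↔⇒≡)
open import Data.Fin.Properties using (+↔⊎)
open import Data.Integer as ℤ using (ℤ; +_; -[1+_]; _-_; _≤_; +≤+)
import Data.Integer.Properties as ℤ
open import Algebra.Properties.AbelianGroup ℤ.+-0-abelianGroup using (//-rightDividesˡ; //-rightDividesʳ)
open import Data.List using (List; []; _∷_; _++_; reverse)
open import Data.List.Properties using (reverse-++; reverse-involutive)
open import Data.List.Relation.Unary.All as All using (All; []; _∷_)
open import Data.Maybe using (Maybe; just; nothing)
open import Data.Maybe.Properties using (just-injective)
open import Data.Nat as ℕ using (ℕ; suc; z≤n; _+_; _*_)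
import Data.Nat.Properties as ℕ
open import Data.Nat.Tactic.RingSolver using (solve-∀)
open import Data.Product using (Σ; _×_; _,_; proj₁; proj₂)
open import Data.Product.Properties using (≡-dec)
open import Data.Sum using (_⊎_; inj₁; inj₂)
open import Data.Sum.Function.Propositional using (_⊎-↔_)
open import Defs
open import Function.Base using (_∘′_)
open import Function.Bundles using (_↔_; mk↔ₛ′)
open import Function.Properties.Inverse using (↔-sym; ↔-trans)
open import Relation.Nullary using (¬_)
open import Relation.Binary.PropositionalEquality

AboveAxis : ℤ × ℤ → Set
AboveAxis v = + 0 ≤ proj₂ v

above : ∀ {a} → + 0 ≤ + a
above = +≤+ z≤n

Path : ℕ → ℤ → Set
Path n k = Σ (List Step) λ p →
  VertConstrained p × All AboveAxis (vertices p) × endpoint p ≡ (+ n , k)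

Diagonal⇒¬Vertical : ∀ {s} → Diagonal s → Vertical s → ⊥
Diagonal⇒¬Vertical up-d   ()
Diagonal⇒¬Vertical down-d ()

Diagonal-irrelevant : ∀ {s} (d d′ : Diagonal s) → d ≡ d′
Diagonal-irrelevant up-d   up-d   = refl
Diagonal-irrelevant down-d down-d = refl

Vertical-irrelevant : ∀ {s} (v v′ : Vertical s) → v ≡ v′
Vertical-irrelevant north-v north-v = refl
Vertical-irrelevant south-v south-v = refl

VertConstrained-irrelevant : ∀ {p} (c c′ : VertConstrained p) → c ≡ c′
VertConstrained-irrelevant vc-nil     vc-nil      = refl
VertConstrained-irrelevant (vc-one s) (vc-one .s) = refl
VertConstrained-irrelevant (vc-diag₁ d c) (vc-diag₁ d′ c′) =
  cong₂ vc-diag₁ (Diagonal-irrelevant d d′) (VertConstrained-irrelevant c c′)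
VertConstrained-irrelevant (vc-diag₁ d _) (vc-diag₂ v _ _) = ⊥-elim (Diagonal⇒¬Vertical d v)
VertConstrained-irrelevant (vc-diag₂ v _ _) (vc-diag₁ d _) = ⊥-elim (Diagonal⇒¬Vertical d v)
VertConstrained-irrelevant (vc-diag₂ v d c) (vc-diag₂ v′ d′ c′)
  rewrite Vertical-irrelevant v v′ | Diagonal-irrelevant d d′ | VertConstrained-irrelevant c c′ = refl

AllAboveAxis-irrelevant : ∀ {vs} (a a′ : All AboveAxis vs) → a ≡ a′
AllAboveAxis-irrelevant = All.irrelevant ℤ.≤-irrelevant

point-≡-irrelevant : {u v : ℤ × ℤ} (e e′ : u ≡ v) → e ≡ e′
point-≡-irrelevant = Decidable⇒UIP.≡-irrelevant (≡-dec ℤ._≟_ ℤ._≟_)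

Path-≡ : ∀ {n k} (x y : Path n k) → proj₁ x ≡ proj₁ y → x ≡ y
Path-≡ (p , c , a , e) (.p , c′ , a′ , e′) refl
  rewrite VertConstrained-irrelevant c c′ | AllAboveAxis-irrelevant a a′
        | point-≡-irrelevant e e′ = refl

endFrom-++ : ∀ v xs ys → endFrom v (xs ++ ys) ≡ endFrom (endFrom v xs) ys
endFrom-++ v []       ys = refl
endFrom-++ v (s ∷ xs) ys = endFrom-++ (addV v (vecOf s)) xs ys

module _ {P : ℤ × ℤ → Set} where

  All-verticesFrom-head : ∀ v ys → All P (verticesFrom v ys) → P v
  All-verticesFrom-head v []      (pv ∷ _) = pv
  All-verticesFrom-head v (_ ∷ _) (pv ∷ _) = pv

  All-verticesFrom-last : ∀ v p → All P (verticesFrom v p) → P (endFrom v p)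
  All-verticesFrom-last v []      (pv ∷ []) = pv
  All-verticesFrom-last v (s ∷ p) (_ ∷ a)   = All-verticesFrom-last (addV v (vecOf s)) p a

  All-verticesFrom-++⁻ : ∀ v xs ys → All P (verticesFrom v (xs ++ ys)) →
    All P (verticesFrom v xs) × All P (verticesFrom (endFrom v xs) ys)
  All-verticesFrom-++⁻ v []       ys a = All-verticesFrom-head v ys a ∷ [] , a
  All-verticesFrom-++⁻ v (s ∷ xs) ys (pv ∷ a) =
    let l , r = All-verticesFrom-++⁻ (addV v (vecOf s)) xs ys a in pv ∷ l , r

  All-verticesFrom-++⁺ : ∀ v xs ys → All P (verticesFrom v xs) →
    All P (verticesFrom (endFrom v xs) ys) → All P (verticesFrom v (xs ++ ys))
  All-verticesFrom-++⁺ v []       ys _        r = r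
  All-verticesFrom-++⁺ v (s ∷ xs) ys (pv ∷ l) r = pv ∷ All-verticesFrom-++⁺ (addV v (vecOf s)) xs ys l r

VertConstrained-tail : ∀ {s ss} → VertConstrained (s ∷ ss) → VertConstrained ss
VertConstrained-tail (vc-one _)       = vc-nil
VertConstrained-tail (vc-diag₁ _ c)   = c
VertConstrained-tail (vc-diag₂ _ _ c) = c

VertConstrained-++⁻ˡ : ∀ xs ys → VertConstrained (xs ++ ys) → VertConstrained xs
VertConstrained-++⁻ˡ []           ys _                = vc-nil
VertConstrained-++⁻ˡ (s ∷ [])     ys _                = vc-one s
VertConstrained-++⁻ˡ (s ∷ t ∷ xs) ys (vc-diag₁ d c)   = vc-diag₁ d (VertConstrained-++⁻ˡ (t ∷ xs) ys c)
VertConstrained-++⁻ˡ (s ∷ t ∷ xs) ys (vc-diag₂ v d c) = vc-diag₂ v d (VertConstrained-++⁻ˡ (t ∷ xs) ys c)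

VertConstrained-++-diagonal : ∀ xs {t ys} → Diagonal t → VertConstrained xs →
  VertConstrained (t ∷ ys) → VertConstrained (xs ++ t ∷ ys)
VertConstrained-++-diagonal []            d _ c = c
VertConstrained-++-diagonal (up ∷ [])     d _ c = vc-diag₁ up-d c
VertConstrained-++-diagonal (down ∷ [])   d _ c = vc-diag₁ down-d c
VertConstrained-++-diagonal (north ∷ [])  d _ c = vc-diag₂ north-v d c
VertConstrained-++-diagonal (south ∷ [])  d _ c = vc-diag₂ south-v d c
VertConstrained-++-diagonal (s ∷ s′ ∷ xs) d (vc-diag₁ d′ c) c′ =
  vc-diag₁ d′ (VertConstrained-++-diagonal (s′ ∷ xs) d c c′)
VertConstrained-++-diagonal (s ∷ s′ ∷ xs) d (vc-diag₂ v d′ c) c′ =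
  vc-diag₂ v d′ (VertConstrained-++-diagonal (s′ ∷ xs) d c c′)

AllVertical-VertConstrained : ∀ {p} → VertConstrained p → All Vertical p →
  p ≡ [] ⊎ Σ Step (λ s → Vertical s × p ≡ s ∷ [])
AllVertical-VertConstrained vc-nil           _           = inj₁ refl
AllVertical-VertConstrained (vc-one s)       (v ∷ [])    = inj₂ (s , v , refl)
AllVertical-VertConstrained (vc-diag₁ d _)   (v ∷ _)     = ⊥-elim (Diagonal⇒¬Vertical d v)
AllVertical-VertConstrained (vc-diag₂ _ d _) (_ ∷ v ∷ _) = ⊥-elim (Diagonal⇒¬Vertical d v)

data Block : Set where
  ↗ ↘ ↗↑ ↗↓ ↘↑ ↘↓ : Block

stepsOf : Block → List Step
stepsOf ↗  = up ∷ []
stepsOf ↘  = down ∷ []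
stepsOf ↗↑ = up ∷ north ∷ []
stepsOf ↗↓ = up ∷ south ∷ []
stepsOf ↘↑ = down ∷ north ∷ []
stepsOf ↘↓ = down ∷ south ∷ []

rise : Block → ℤ
rise ↗  = + 1
rise ↘  = -[1+ 0 ]
rise ↗↑ = + 2
rise ↗↓ = + 0
rise ↘↑ = + 0
rise ↘↓ = -[1+ 1 ]

endFrom-stepsOf : ∀ a b t → endFrom (a , b) (stepsOf t) ≡ (a ℤ.+ + 1 , b ℤ.+ rise t)
endFrom-stepsOf a b ↗  = refl
endFrom-stepsOf a b ↘  = refl
endFrom-stepsOf a b ↗↑ = cong₂ _,_ (ℤ.+-identityʳ _) (ℤ.+-assoc b _ _)
endFrom-stepsOf a b ↗↓ = cong₂ _,_ (ℤ.+-identityʳ _) (ℤ.+-assoc b _ _)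
endFrom-stepsOf a b ↘↑ = cong₂ _,_ (ℤ.+-identityʳ _) (ℤ.+-assoc b _ _)
endFrom-stepsOf a b ↘↓ = cong₂ _,_ (ℤ.+-identityʳ _) (ℤ.+-assoc b _ _)

VertConstrained-++-stepsOf : ∀ q t → VertConstrained q → VertConstrained (q ++ stepsOf t)
VertConstrained-++-stepsOf q ↗  c = VertConstrained-++-diagonal q up-d c (vc-one up)
VertConstrained-++-stepsOf q ↘  c = VertConstrained-++-diagonal q down-d c (vc-one down)
VertConstrained-++-stepsOf q ↗↑ c = VertConstrained-++-diagonal q up-d c (vc-diag₁ up-d (vc-one north))
VertConstrained-++-stepsOf q ↗↓ c = VertConstrained-++-diagonal q up-d c (vc-diag₁ up-d (vc-one south))
VertConstrained-++-stepsOf q ↘↑ c = VertConstrained-++-diagonal q down-d c (vc-diag₁ down-d (vc-one north))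
VertConstrained-++-stepsOf q ↘↓ c = VertConstrained-++-diagonal q down-d c (vc-diag₁ down-d (vc-one south))

record BlockSplit (p : List Step) : Set where
  constructor split
  field
    block  : Block
    prefix : List Step
    p≡     : p ≡ prefix ++ stepsOf block

BlockSplit-∷ : ∀ s {p} → BlockSplit p → BlockSplit (s ∷ p)
BlockSplit-∷ s (split t q refl) = split t (s ∷ q) refl

BlockSplit-last2 : ∀ {s t ss} → VertConstrained (s ∷ t ∷ ss) → Vertical t →
  All Vertical ss → BlockSplit (s ∷ t ∷ ss)
BlockSplit-last2 (vc-diag₂ _ d _) v _ = ⊥-elim (Diagonal⇒¬Vertical d v)
BlockSplit-last2 {ss = _ ∷ _} (vc-diag₁ _ (vc-diag₁ d _)) v _ = ⊥-elim (Diagonal⇒¬Vertical d v)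
BlockSplit-last2 {ss = _ ∷ _} (vc-diag₁ _ (vc-diag₂ _ d _)) _ (v ∷ _) = ⊥-elim (Diagonal⇒¬Vertical d v)
BlockSplit-last2 {ss = []} (vc-diag₁ up-d   _) north-v _ = split ↗↑ [] refl
BlockSplit-last2 {ss = []} (vc-diag₁ up-d   _) south-v _ = split ↗↓ [] refl
BlockSplit-last2 {ss = []} (vc-diag₁ down-d _) north-v _ = split ↘↑ [] refl
BlockSplit-last2 {ss = []} (vc-diag₁ down-d _) south-v _ = split ↘↓ [] refl

blockSplit⊎allVertical : ∀ p → VertConstrained p → BlockSplit p ⊎ All Vertical p
blockSplit⊎allVertical []           _ = inj₂ []
blockSplit⊎allVertical (up ∷ [])    _ = inj₁ (split ↗ [] refl)
blockSplit⊎allVertical (down ∷ [])  _ = inj₁ (split ↘ [] refl)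
blockSplit⊎allVertical (north ∷ []) _ = inj₂ (north-v ∷ [])
blockSplit⊎allVertical (south ∷ []) _ = inj₂ (south-v ∷ [])
blockSplit⊎allVertical (s ∷ t ∷ ss) c with blockSplit⊎allVertical (t ∷ ss) (VertConstrained-tail c)
... | inj₁ b        = inj₁ (BlockSplit-∷ s b)
... | inj₂ (v ∷ vs) = inj₁ (BlockSplit-last2 c v vs)

-- The reversed block is read off the front of the reversed path, which gives uniqueness.
unsnocBlock : List Step → Maybe (Block × List Step)
unsnocBlock (up ∷ r)           = just (↗ , r)
unsnocBlock (down ∷ r)         = just (↘ , r)
unsnocBlock (north ∷ up ∷ r)   = just (↗↑ , r)
unsnocBlock (south ∷ up ∷ r)   = just (↗↓ , r)
unsnocBlock (north ∷ down ∷ r) = just (↘↑ , r)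
unsnocBlock (south ∷ down ∷ r) = just (↘↓ , r)
unsnocBlock _                  = nothing

unsnocBlock-reverse : ∀ q t → unsnocBlock (reverse (q ++ stepsOf t)) ≡ just (t , reverse q)
unsnocBlock-reverse q t rewrite reverse-++ q (stepsOf t) with t
... | ↗  = refl
... | ↘  = refl
... | ↗↑ = refl
... | ↗↓ = refl
... | ↘↑ = refl
... | ↘↓ = refl

++-stepsOf-injective : ∀ {q q′ t t′} → q ++ stepsOf t ≡ q′ ++ stepsOf t′ → t ≡ t′ × q ≡ q′
++-stepsOf-injective {q} {q′} {t} {t′} e = cong proj₁ same , (begin
    q                     ≡⟨ reverse-involutive q ⟨
    reverse (reverse q)   ≡⟨ cong (reverse ∘′ proj₂) same ⟩
    reverse (reverse q′)  ≡⟨ reverse-involutive q′ ⟩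
    q′                    ∎)
  where
  open ≡-Reasoning
  same : (t , reverse q) ≡ (t′ , reverse q′)
  same = just-injective (begin
    just (t , reverse q)                      ≡⟨ unsnocBlock-reverse q t ⟨
    unsnocBlock (reverse (q ++ stepsOf t))    ≡⟨ cong (unsnocBlock ∘′ reverse) e ⟩
    unsnocBlock (reverse (q′ ++ stepsOf t′))  ≡⟨ unsnocBlock-reverse q′ t′ ⟩
    just (t′ , reverse q′)                    ∎)

BlockAbove : ℤ × ℤ → Block → Set
BlockAbove v t = All AboveAxis (verticesFrom v (stepsOf t))

record Extension (n : ℕ) (k : ℤ) (t : Block) : Set where
  constructor _,_
  field
    path       : Path n (k - rise t)
    blockAbove : BlockAbove (+ n , k - rise t) t

blockStart : ∀ {n k} v t → endFrom v (stepsOf t) ≡ (+ suc n , k) → v ≡ (+ n , k - rise t)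
blockStart {n} {k} (a , b) t e = cong₂ _,_
  (begin
    a                      ≡⟨ //-rightDividesʳ (+ 1) a ⟨
    a ℤ.+ + 1 - + 1        ≡⟨ cong (λ v → proj₁ v - + 1) e′ ⟩
    + suc n - + 1          ≡⟨ cong (λ i → + i - + 1) (ℕ.+-comm 1 n) ⟩
    + n ℤ.+ + 1 - + 1      ≡⟨ //-rightDividesʳ (+ 1) (+ n) ⟩
    + n                    ∎)
  (begin
    b                      ≡⟨ //-rightDividesʳ (rise t) b ⟨
    b ℤ.+ rise t - rise t  ≡⟨ cong (λ v → proj₂ v - rise t) e′ ⟩
    k - rise t             ∎)
  where
  open ≡-Reasoning
  e′ : (a ℤ.+ + 1 , b ℤ.+ rise t) ≡ (+ suc n , k)
  e′ = trans (sym (endFrom-stepsOf a b t)) e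

extend : ∀ {n k} → Σ Block (Extension n k) → Path (suc n) k
extend {n} {k} (t , (q , c , a , e) , a′) =
  q ++ stepsOf t ,
  VertConstrained-++-stepsOf q t c ,
  All-verticesFrom-++⁺ _ q (stepsOf t) a (subst (λ v → BlockAbove v t) (sym e) a′) ,
  (begin
    endpoint (q ++ stepsOf t)                ≡⟨ endFrom-++ _ q (stepsOf t) ⟩
    endFrom (endpoint q) (stepsOf t)         ≡⟨ cong (λ v → endFrom v (stepsOf t)) e ⟩
    endFrom (+ n , k - rise t) (stepsOf t)   ≡⟨ endFrom-stepsOf (+ n) (k - rise t) t ⟩
    (+ n ℤ.+ + 1 , k - rise t ℤ.+ rise t)    ≡⟨ cong₂ _,_ (cong +_ (ℕ.+-comm n 1))
                                                          (//-rightDividesˡ (rise t) k) ⟩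
    (+ suc n , k)                            ∎)
  where open ≡-Reasoning

cut : ∀ {n k} p → VertConstrained p → All AboveAxis (vertices p) →
  endpoint p ≡ (+ suc n , k) → BlockSplit p → Σ Block (Extension n k)
cut .(q ++ stepsOf t) c a e (split t q refl) =
  t , (q , VertConstrained-++⁻ˡ q (stepsOf t) c , proj₁ a-split , start) ,
  subst (λ v → BlockAbove v t) start (proj₂ a-split)
  where
  a-split = All-verticesFrom-++⁻ _ q (stepsOf t) a
  start = blockStart (endpoint q) t (trans (sym (endFrom-++ _ q (stepsOf t))) e)

lastBlock : ∀ {n k} p → VertConstrained p → endpoint p ≡ (+ suc n , k) → BlockSplit p
lastBlock p c e with blockSplit⊎allVertical p c
... | inj₁ b  = b
... | inj₂ vs with AllVertical-VertConstrained c vs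
lastBlock .[]            _ () | inj₂ _ | inj₁ refl
lastBlock .(north ∷ [])  _ () | inj₂ _ | inj₂ (north , _ , refl)
lastBlock .(south ∷ [])  _ () | inj₂ _ | inj₂ (south , _ , refl)

restrict : ∀ {n k} → Path (suc n) k → Σ Block (Extension n k)
restrict (p , c , a , e) = cut p c a e (lastBlock p c e)

extend∘cut : ∀ {n k} p c a e b → extend {n} {k} (cut p c a e b) ≡ (p , c , a , e)
extend∘cut .(q ++ stepsOf t) _ _ _ (split t q refl) = Path-≡ _ _ refl

cut∘extend : ∀ {n k} p c a e (b : BlockSplit p) t q x (a′ : BlockAbove (+ n , k - rise t) t) →
  p ≡ q ++ stepsOf t → cut {n} {k} p c a e b ≡ (t , (q , x) , a′)
cut∘extend .(q′ ++ stepsOf t′) _ _ _ (split t′ q′ refl) t q x a′ p≡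
  with ++-stepsOf-injective {q′} {q} {t′} {t} p≡
... | refl , refl = cong₂ (λ y z → t , y , z) (Path-≡ _ _ refl) (AllAboveAxis-irrelevant _ _)

Extension↔Path : ∀ {n k t} → BlockAbove (+ n , k - rise t) t → Extension n k t ↔ Path n (k - rise t)
Extension↔Path a = mk↔ₛ′ Extension.path (_, a) (λ _ → refl)
  (λ (x , a′) → cong (x ,_) (AllAboveAxis-irrelevant a a′))

Path-suc↔ : ∀ n k → Path (suc n) k ↔ Σ Block (Extension n k)
Path-suc↔ n k = mk↔ₛ′ restrict extend
  (λ { (t , (q , x) , a′) → cut∘extend _ _ _ _ (lastBlock _ _ _) t q x a′ refl })
  (λ { (p , c , a , e) → extend∘cut p c a e (lastBlock p c e) })

Σ-Block↔⊎ : (F : Block → Set) → Σ Block F ↔ (F ↗ ⊎ (F ↘ ⊎ (F ↗↑ ⊎ (F ↗↓ ⊎ (F ↘↑ ⊎ F ↘↓)))))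
Σ-Block↔⊎ F = mk↔ₛ′ to from
  (λ { (inj₁ _) → refl ; (inj₂ (inj₁ _)) → refl ; (inj₂ (inj₂ (inj₁ _))) → refl
     ; (inj₂ (inj₂ (inj₂ (inj₁ _)))) → refl ; (inj₂ (inj₂ (inj₂ (inj₂ (inj₁ _))))) → refl
     ; (inj₂ (inj₂ (inj₂ (inj₂ (inj₂ _))))) → refl })
  (λ { (↗ , _) → refl ; (↘ , _) → refl ; (↗↑ , _) → refl ; (↗↓ , _) → refl
     ; (↘↑ , _) → refl ; (↘↓ , _) → refl })
  where
  to : Σ Block F → F ↗ ⊎ (F ↘ ⊎ (F ↗↑ ⊎ (F ↗↓ ⊎ (F ↘↑ ⊎ F ↘↓))))
  to (↗  , x) = inj₁ x
  to (↘  , x) = inj₂ (inj₁ x)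
  to (↗↑ , x) = inj₂ (inj₂ (inj₁ x))
  to (↗↓ , x) = inj₂ (inj₂ (inj₂ (inj₁ x)))
  to (↘↑ , x) = inj₂ (inj₂ (inj₂ (inj₂ (inj₁ x))))
  to (↘↓ , x) = inj₂ (inj₂ (inj₂ (inj₂ (inj₂ x))))
  from : F ↗ ⊎ (F ↘ ⊎ (F ↗↑ ⊎ (F ↗↓ ⊎ (F ↘↑ ⊎ F ↘↓)))) → Σ Block F
  from (inj₁ x)                              = ↗  , x
  from (inj₂ (inj₁ x))                       = ↘  , x
  from (inj₂ (inj₂ (inj₁ x)))                = ↗↑ , x
  from (inj₂ (inj₂ (inj₂ (inj₁ x))))         = ↗↓ , x
  from (inj₂ (inj₂ (inj₂ (inj₂ (inj₁ x)))))  = ↘↑ , x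
  from (inj₂ (inj₂ (inj₂ (inj₂ (inj₂ x)))))  = ↘↓ , x

blockSum : (Block → ℕ) → ℕ
blockSum c = c ↗ + (c ↘ + (c ↗↑ + (c ↗↓ + (c ↘↑ + c ↘↓))))

Σ-Block↔Fin : ∀ {F : Block → Set} (c : Block → ℕ) → (∀ t → F t ↔ Fin (c t)) →
  Σ Block F ↔ Fin (blockSum c)
Σ-Block↔Fin {F} c f = ↔-trans (Σ-Block↔⊎ F)
  (f ↗ ⊎+ (f ↘ ⊎+ (f ↗↑ ⊎+ (f ↗↓ ⊎+ (f ↘↑ ⊎+ f ↘↓)))))
  where
  _⊎+_ : ∀ {A C a c} → A ↔ Fin a → C ↔ Fin c → (A ⊎ C) ↔ Fin (a + c)
  f ⊎+ g = ↔-trans (f ⊎-↔ g) (↔-sym +↔⊎)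

¬⇒↔Fin0 : ∀ {A : Set} → (A → ⊥) → A ↔ Fin 0
¬⇒↔Fin0 ¬a = mk↔ₛ′ (λ a → ⊥-elim (¬a a)) (λ ()) (λ ()) (λ a → ⊥-elim (¬a a))

unique⇒↔Fin1 : ∀ {A : Set} (a : A) → (∀ x → x ≡ a) → A ↔ Fin 1
unique⇒↔Fin1 a unique = mk↔ₛ′ (λ _ → Fin.zero) (λ _ → a)
  (λ { Fin.zero → refl ; (Fin.suc ()) }) (λ x → sym (unique x))

Path-below-empty : ∀ {n j} → Path n -[1+ j ] → ⊥
Path-below-empty (p , _ , a , e) with subst AboveAxis e (All-verticesFrom-last _ p a)
... | ()

diagonalSteps : List Step → ℕ
diagonalSteps []           = 0
diagonalSteps (up ∷ p)     = suc (diagonalSteps p)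
diagonalSteps (down ∷ p)   = suc (diagonalSteps p)
diagonalSteps (north ∷ p)  = diagonalSteps p
diagonalSteps (south ∷ p)  = diagonalSteps p

endFrom-x : ∀ a b p → proj₁ (endFrom (a , b) p) ≡ a ℤ.+ + diagonalSteps p
endFrom-x a b []          = sym (ℤ.+-identityʳ a)
endFrom-x a b (up ∷ p)    = trans (endFrom-x (a ℤ.+ + 1) _ p) (ℤ.+-assoc a (+ 1) _)
endFrom-x a b (down ∷ p)  = trans (endFrom-x (a ℤ.+ + 1) _ p) (ℤ.+-assoc a (+ 1) _)
endFrom-x a b (north ∷ p) = trans (endFrom-x (a ℤ.+ + 0) _ p) (cong (ℤ._+ _) (ℤ.+-identityʳ a))
endFrom-x a b (south ∷ p) = trans (endFrom-x (a ℤ.+ + 0) _ p) (cong (ℤ._+ _) (ℤ.+-identityʳ a))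

BlockSplit⇒x≢0 : ∀ {p k} → BlockSplit p → endpoint p ≢ (+ 0 , k)
BlockSplit⇒x≢0 (split t q refl) e = ℕ.m+1+n≢0 (diagonalSteps q) (ℤ.+-injective (begin
  + diagonalSteps q ℤ.+ + 1                 ≡⟨ cong (ℤ._+ + 1) (endFrom-x _ _ q) ⟨
  proj₁ (endpoint q) ℤ.+ + 1                ≡⟨ cong proj₁ (endFrom-stepsOf _ _ t) ⟨
  proj₁ (endFrom (endpoint q) (stepsOf t))  ≡⟨ cong proj₁ (endFrom-++ _ q (stepsOf t)) ⟨
  proj₁ (endpoint (q ++ stepsOf t))         ≡⟨ cong proj₁ e ⟩
  + 0                                       ∎))
  where open ≡-Reasoning

Path-zero : ∀ {k} (x : Path 0 k) → proj₁ x ≡ [] × k ≡ + 0 ⊎ proj₁ x ≡ north ∷ [] × k ≡ + 1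
Path-zero (p , c , a , e) with blockSplit⊎allVertical p c
... | inj₁ b  = ⊥-elim (BlockSplit⇒x≢0 b e)
... | inj₂ vs with AllVertical-VertConstrained c vs
... | inj₁ refl                    = inj₁ (refl , sym (cong proj₂ e))
... | inj₂ (north , _ , refl)      = inj₂ (refl , sym (cong proj₂ e))
Path-zero (_ , _ , _ ∷ () ∷ [] , _) | inj₂ _ | inj₂ (south , _ , refl)

module Counting (B : ℕ → ℕ → ℕ) (counts : Counts B) where

  B-suc : ∀ n m (c : Block → ℕ) → (∀ t → Extension n (+ m) t ↔ Fin (c t)) →
    B (suc n) m ≡ blockSum c
  B-suc n m c f = ↔⇒≡ (↔-trans (counts (suc n) m) (↔-trans (Path-suc↔ n (+ m)) (Σ-Block↔Fin c f)))

  Extension↔B : ∀ {n k t} m → k - rise t ≡ + m → BlockAbove (+ n , k - rise t) t →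
    Extension n k t ↔ Fin (B n m)
  Extension↔B {n} m e a =
    ↔-trans (Extension↔Path a) (subst (λ j → Path n j ↔ Fin (B n m)) (sym e) (↔-sym (counts n m)))

  Extension-below-empty : ∀ {n k t j} → k - rise t ≡ -[1+ j ] → Extension n k t ↔ Fin 0
  Extension-below-empty e = ¬⇒↔Fin0 λ (x , _) → Path-below-empty (subst (Path _) e x)

  Extension-block-empty : ∀ {n k t} → ¬ BlockAbove (+ n , k - rise t) t → Extension n k t ↔ Fin 0
  Extension-block-empty ¬a = ¬⇒↔Fin0 λ (_ , a) → ¬a a

  B-zero-zero : B 0 0 ≡ 1
  B-zero-zero = ↔⇒≡ (↔-trans (counts 0 0) (unique⇒↔Fin1 empty λ x → Path-≡ x empty (path≡ x)))
    where
    empty : Path 0 (+ 0)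
    empty = [] , vc-nil , above ∷ [] , refl
    path≡ : (x : Path 0 (+ 0)) → proj₁ x ≡ []
    path≡ x with Path-zero x
    ... | inj₁ (p≡ , _) = p≡
    ... | inj₂ (_ , ())

  B-zero-one : B 0 1 ≡ 1
  B-zero-one = ↔⇒≡ (↔-trans (counts 0 1) (unique⇒↔Fin1 north! λ x → Path-≡ x north! (path≡ x)))
    where
    north! : Path 0 (+ 1)
    north! = north ∷ [] , vc-one north , above ∷ above ∷ [] , refl
    path≡ : (x : Path 0 (+ 1)) → proj₁ x ≡ north ∷ []
    path≡ x with Path-zero x
    ... | inj₁ (_ , ())
    ... | inj₂ (p≡ , _) = p≡

  B-zero-high : ∀ m → B 0 (suc (suc m)) ≡ 0
  B-zero-high m = ↔⇒≡ (↔-trans (counts 0 (suc (suc m))) (¬⇒↔Fin0 none))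
    where
    none : Path 0 (+ suc (suc m)) → ⊥
    none x with Path-zero x
    ... | inj₁ (_ , ())
    ... | inj₂ (_ , ())

  B-suc-zero : ∀ n → B (suc n) 0 ≡ B n 2 + B n 1 + B n 0
  B-suc-zero n = trans (B-suc n 0 count λ
    { ↗  → Extension-below-empty refl
    ; ↘  → Extension↔B 1 refl (above ∷ above ∷ [])
    ; ↗↑ → Extension-below-empty refl
    ; ↗↓ → Extension↔B 0 refl (above ∷ above ∷ above ∷ [])
    ; ↘↑ → Extension-block-empty λ { (_ ∷ () ∷ _) }
    ; ↘↓ → Extension↔B 2 refl (above ∷ above ∷ above ∷ [])
    }) (rearrange (B n 0) (B n 1) (B n 2))
    where
    count : Block → ℕ
    count ↗  = 0
    count ↘  = B n 1
    count ↗↑ = 0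
    count ↗↓ = B n 0
    count ↘↑ = 0
    count ↘↓ = B n 2
    rearrange : ∀ b₀ b₁ b₂ → 0 + (b₁ + (0 + (b₀ + (0 + b₂)))) ≡ b₂ + b₁ + b₀
    rearrange = solve-∀

  B-suc-one : ∀ n → B (suc n) 1 ≡ B n 3 + B n 2 + 2 * B n 1 + B n 0
  B-suc-one n = trans (B-suc n 1 count λ
    { ↗  → Extension↔B 0 refl (above ∷ above ∷ [])
    ; ↘  → Extension↔B 2 refl (above ∷ above ∷ [])
    ; ↗↑ → Extension-below-empty refl
    ; ↗↓ → Extension↔B 1 refl (above ∷ above ∷ above ∷ [])
    ; ↘↑ → Extension↔B 1 refl (above ∷ above ∷ above ∷ [])
    ; ↘↓ → Extension↔B 3 refl (above ∷ above ∷ above ∷ [])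
    }) (rearrange (B n 0) (B n 1) (B n 2) (B n 3))
    where
    count : Block → ℕ
    count ↗  = B n 0
    count ↘  = B n 2
    count ↗↑ = 0
    count ↗↓ = B n 1
    count ↘↑ = B n 1
    count ↘↓ = B n 3
    rearrange : ∀ b₀ b₁ b₂ b₃ →
      b₀ + (b₂ + (0 + (b₁ + (b₁ + b₃)))) ≡ b₃ + b₂ + 2 * b₁ + b₀
    rearrange = solve-∀

  B-suc-high : ∀ n m → B (suc n) (suc (suc m))
    ≡ B n (suc (suc m) + 2) + B n (suc (suc m) + 1) + 2 * B n (suc (suc m))
      + B n (suc m) + B n m
  B-suc-high n m = trans (B-suc n (suc (suc m)) count λ
    { ↗  → Extension↔B (suc m) refl (above ∷ above ∷ [])
    ; ↘  → Extension↔B (suc (suc m) + 1) refl (above ∷ above ∷ [])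
    ; ↗↑ → Extension↔B m refl (above ∷ above ∷ above ∷ [])
    ; ↗↓ → Extension↔B (suc (suc m)) (ℤ.+-identityʳ _) (above ∷ above ∷ above ∷ [])
    ; ↘↑ → Extension↔B (suc (suc m)) (ℤ.+-identityʳ _) (above ∷ above ∷ above ∷ [])
    ; ↘↓ → Extension↔B (suc (suc m) + 2) refl (above ∷ above ∷ above ∷ [])
    }) (rearrange (B n (suc (suc m) + 2)) (B n (suc (suc m) + 1)) (B n (suc (suc m)))
                  (B n (suc m)) (B n m))
    where
    count : Block → ℕ
    count ↗  = B n (suc m)
    count ↘  = B n (suc (suc m) + 1)
    count ↗↑ = B n m
    count ↗↓ = B n (suc (suc m))
    count ↘↑ = B n (suc (suc m))
    count ↘↓ = B n (suc (suc m) + 2)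
    rearrange : ∀ b₊₂ b₊₁ b b₋₁ b₋₂ →
      b₋₁ ℕ.+ (b₊₁ ℕ.+ (b₋₂ ℕ.+ (b ℕ.+ (b ℕ.+ b₊₂)))) ≡ b₊₂ ℕ.+ b₊₁ ℕ.+ 2 * b ℕ.+ b₋₁ ℕ.+ b₋₂
    rearrange = solve-∀

lemma12 : (B : ℕ → ℕ → ℕ) → Counts B →
    (B 0 0 ≡ 1) × (B 0 1 ≡ 1) × (∀ m → B 0 (suc (suc m)) ≡ 0) ×
    (∀ n → B (suc n) 0 ≡ B n 2 + B n 1 + B n 0) ×
    (∀ n → B (suc n) 1 ≡ B n 3 + B n 2 + 2 * B n 1 + B n 0) ×
    (∀ n m → B (suc n) (suc (suc m))
               ≡ B n (suc (suc m) + 2) + B n (suc (suc m) + 1) + 2 * B n (suc (suc m))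
                 + B n (suc m) + B n m)
lemma12 B counts =
  B-zero-zero , B-zero-one , B-zero-high , B-suc-zero , B-suc-one , B-suc-high
  where open Counting B counts
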